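{- Let $n$ people $v_1,\dots,v_n$ each initially know exactly one item of gossip (her own, all items distinct), and suppose they make calls $e_1,e_2,\dots,e_m$ in this order, where each call is an unordered pair of two distinct people and during a call each participant learns every item known by the other. Let $t$ be an integer with $1\le t\le m$ and $1\le t<n$. Then at most $t+1$ pieces of news are communicated in call $e_t$; that is, the number of pairs (participant of $e_t$, item) such that the participant learns that item during call $e_t$ is at most $t+1$.
   Context: Calls happen one after another in the given order; in a call, both participants' knowledge sets become the union of their knowledge sets before the call. -}

module Defs where

open import Data.Nat using (ℕ; zero; suc; _+_; _<_)
open import Data.Bool using (Bool; true; false; _∨_; not; _∧_)
open import Data.Fin using (Fin; _≟_)
open import Data.Product using (_×_; _,_; proj₁; proj₂)
open import Data.List using (List; []; _∷_; foldl; take)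
open import Data.Vec.Functional using (Vector; foldr; map)
open import Relation.Nullary.Decidable using (⌊_⌋)
open import Relation.Binary.PropositionalEquality using (_≢_)

-- A call between people of {0..n-1}: an ordered representation (a , b) of the
-- unordered pair {a , b}; the gossip process is symmetric in a and b.
Call : ℕ → Set
Call n = Fin n × Fin n

ValidCall : ∀ {n} → Call n → Set
ValidCall (a , b) = a ≢ b

-- Knowledge state: K p i = true iff person p knows item i.
-- (Item i is the gossip originally belonging to person i.)
Knowledge : ℕ → Set
Knowledge n = Fin n → Fin n → Bool

initial : ∀ {n} → Knowledge n
initial p i = ⌊ p ≟ i ⌋

call : ∀ {n} → Knowledge n → Call n → Knowledge n
call K (a , b) p i with ⌊ p ≟ a ⌋ ∨ ⌊ p ≟ b ⌋
... | true  = K a i ∨ K b i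
... | false = K p i

run : ∀ {n} → List (Call n) → Knowledge n
run cs = foldl call initial cs

countTrue : ∀ {n} → Vector Bool n → ℕ
countTrue v = foldr _+_ 0 (map (λ { true → 1 ; false → 0 }) v)

learned : ∀ {n} → Knowledge n → Knowledge n → Fin n → ℕ
learned K K' p = countTrue (λ i → not (K p i) ∧ K' p i)

news : ∀ {n} → Knowledge n → Call n → ℕ
news K (a , b) = learned K (call K (a , b)) a + learned K (call K (a , b)) b

{-# OPTIONS --safe #-}
module Submission where

-- Say the excess of a knowledge state is at most j when every group G of people
-- jointly knows at most |G| + j items.  Initially the excess is 0, and a call
-- raises it by at most one: a group containing neither caller knows nothing new,
-- and a group containing one caller already knew, before the call, everything it
-- knows afterwards once the other caller is added to it.  So before call t the
-- excess is at most t - 1.  In a call between a and b each item is learned by at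
-- most one caller, and only if the other one knew it, so the news are at most
-- |K a ∪ K b| ≤ |{a , b}| + (t - 1) ≤ t + 1.

open import Defs
open import Data.Nat using (ℕ; zero; suc; _+_; _⊓_; _≤_; _<_; z≤n; s≤s)
open import Data.Nat.Properties
  using (≤-refl; +-mono-≤; +-monoˡ-≤; +-monoʳ-≤; +-suc; +-comm; +-identityʳ; m≤n⇒m≤1+n; m⊓n≤m;
         +-0-commutativeMonoid; module ≤-Reasoning)
open import Data.Bool using (Bool; true; false; _∨_; _∧_; not; T)
open import Data.Bool.Properties using (T-∨)
open import Data.Fin using (Fin; zero; suc; toℕ; _≟_)
open import Data.List using (List; []; _∷_; length; take; lookup; foldl)
open import Data.List.Properties using (length-take)
open import Data.List.Relation.Unary.All using (All)
open import Data.Vec.Functional using (Vector)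
open import Data.Product using (_×_; _,_; ∃-syntax)
open import Data.Sum using (_⊎_; inj₁; inj₂)
import Data.Sum as Sum
open import Data.Empty using (⊥-elim)
open import Function using (_∘_; id; Equivalence)
open import Relation.Nullary using (yes; no; ¬_)
open import Relation.Nullary.Decidable using (⌊_⌋; ⌊⌋-map′; toWitness; fromWitness; T?)
open import Relation.Binary.PropositionalEquality
  using (_≡_; _≢_; refl; sym; cong; cong₂; trans; subst; module ≡-Reasoning)
open import Algebra.Properties.CommutativeMonoid.Sum +-0-commutativeMonoid
  using (sum; sum-cong-≗; ∑-distrib-+)

private
  variable
    n j : ℕ

_∪_ : Vector Bool n → Vector Bool n → Vector Bool n
(u ∪ v) i = u i ∨ v i

⁅_⁆ : Fin n → Vector Bool n
⁅ x ⁆ i = ⌊ x ≟ i ⌋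

∪⁺ : ∀ (u v : Vector Bool n) {i} → T (u i) ⊎ T (v i) → T ((u ∪ v) i)
∪⁺ u v {i} = Equivalence.from (T-∨ {u i})

x∈⁅x⁆ : (x : Fin n) → T (⁅ x ⁆ x)
x∈⁅x⁆ x = fromWitness refl

bit : Bool → ℕ
bit true  = 1
bit false = 0

bit-mono : ∀ {x y} → (T x → T y) → bit x ≤ bit y
bit-mono {false} _ = z≤n
bit-mono {true} {true} _ = ≤-refl
bit-mono {true} {false} x⇒y = ⊥-elim (x⇒y _)

bit-∨ : ∀ x y → bit (x ∨ y) ≤ bit x + bit y
bit-∨ true  _ = s≤s z≤n
bit-∨ false _ = ≤-refl

sum-mono-≤ : {f g : Vector ℕ n} → (∀ i → f i ≤ g i) → sum f ≤ sum g
sum-mono-≤ {zero}  f≤g = z≤n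
sum-mono-≤ {suc n} f≤g = +-mono-≤ (f≤g zero) (sum-mono-≤ (f≤g ∘ suc))

countTrue≡sum : (u : Vector Bool n) → countTrue u ≡ sum (bit ∘ u)
countTrue≡sum {zero}  u = refl
countTrue≡sum {suc n} u with u zero
... | true  = cong suc (countTrue≡sum (u ∘ suc))
... | false = countTrue≡sum (u ∘ suc)

countTrue-+ : (u v : Vector Bool n) → countTrue u + countTrue v ≡ sum (λ i → bit (u i) + bit (v i))
countTrue-+ u v = begin
  countTrue u + countTrue v                ≡⟨ cong₂ _+_ (countTrue≡sum u) (countTrue≡sum v) ⟩
  sum (bit ∘ u) + sum (bit ∘ v)            ≡⟨ sym (∑-distrib-+ (bit ∘ u) (bit ∘ v)) ⟩
  sum (λ i → bit (u i) + bit (v i))        ∎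
  where open ≡-Reasoning

countTrue-+-≤ : {u v w : Vector Bool n} → (∀ i → bit (u i) + bit (v i) ≤ bit (w i)) →
                countTrue u + countTrue v ≤ countTrue w
countTrue-+-≤ {u = u} {v} {w} u+v≤w = begin
  countTrue u + countTrue v                ≡⟨ countTrue-+ u v ⟩
  sum (λ i → bit (u i) + bit (v i))        ≤⟨ sum-mono-≤ u+v≤w ⟩
  sum (bit ∘ w)                            ≡⟨ sym (countTrue≡sum w) ⟩
  countTrue w                              ∎
  where open ≤-Reasoning

countTrue-cong : {u v : Vector Bool n} → (∀ i → u i ≡ v i) → countTrue u ≡ countTrue v
countTrue-cong {u = u} {v} u≗v = begin
  countTrue u       ≡⟨ countTrue≡sum u ⟩
  sum (bit ∘ u)     ≡⟨ sum-cong-≗ (cong bit ∘ u≗v) ⟩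
  sum (bit ∘ v)     ≡⟨ countTrue≡sum v ⟨
  countTrue v       ∎
  where open ≡-Reasoning

countTrue-mono : {u v : Vector Bool n} → (∀ i → T (u i) → T (v i)) → countTrue u ≤ countTrue v
countTrue-mono {u = u} {v} u⊆v = begin
  countTrue u       ≡⟨ countTrue≡sum u ⟩
  sum (bit ∘ u)     ≤⟨ sum-mono-≤ (bit-mono ∘ u⊆v) ⟩
  sum (bit ∘ v)     ≡⟨ sym (countTrue≡sum v) ⟩
  countTrue v       ∎
  where open ≤-Reasoning

countTrue-∪ : (u v : Vector Bool n) → countTrue (u ∪ v) ≤ countTrue u + countTrue v
countTrue-∪ u v = begin
  countTrue (u ∪ v)                        ≡⟨ countTrue≡sum (u ∪ v) ⟩
  sum (bit ∘ (u ∪ v))                      ≤⟨ sum-mono-≤ (λ i → bit-∨ (u i) (v i)) ⟩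
  sum (λ i → bit (u i) + bit (v i))        ≡⟨ sym (countTrue-+ u v) ⟩
  countTrue u + countTrue v                ∎
  where open ≤-Reasoning

countTrue-∅ : countTrue {n} (λ _ → false) ≡ 0
countTrue-∅ {zero}  = refl
countTrue-∅ {suc n} = countTrue-∅ {n}

countTrue-⁅⁆ : (x : Fin n) → countTrue ⁅ x ⁆ ≡ 1
countTrue-⁅⁆ {suc n} zero    = cong suc (countTrue-∅ {n})
countTrue-⁅⁆         (suc x) = trans (countTrue-cong (λ i → ⌊⌋-map′ _ _ (x ≟ i))) (countTrue-⁅⁆ x)

countTrue-∪⁅⁆ : (u : Vector Bool n) (x : Fin n) → countTrue (u ∪ ⁅ x ⁆) ≤ suc (countTrue u)
countTrue-∪⁅⁆ u x = begin
  countTrue (u ∪ ⁅ x ⁆)                    ≤⟨ countTrue-∪ u ⁅ x ⁆ ⟩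
  countTrue u + countTrue ⁅ x ⁆            ≡⟨ cong (countTrue u +_) (countTrue-⁅⁆ x) ⟩
  countTrue u + 1                          ≡⟨ +-comm (countTrue u) 1 ⟩
  suc (countTrue u)                        ∎
  where open ≤-Reasoning

bit-news-≤ : ∀ x y {x′ y′} → (T x′ → T x ⊎ T y) → (T y′ → T x ⊎ T y) →
             bit (not x ∧ x′) + bit (not y ∧ y′) ≤ bit (x ∨ y)
bit-news-≤ true  true                  _  _  = z≤n
bit-news-≤ true  false {y′ = false}    _  _  = z≤n
bit-news-≤ true  false {y′ = true}     _  _  = ≤-refl
bit-news-≤ false true  {false}         _  _  = z≤n
bit-news-≤ false true  {true}          _  _  = ≤-refl
bit-news-≤ false false {false} {false} _  _  = z≤n
bit-news-≤ false false {true}          x′ _  = ⊥-elim (Sum.reduce (x′ _))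
bit-news-≤ false false {false} {true}  _  y′ = ⊥-elim (Sum.reduce (y′ _))

call-sources : ∀ (K : Knowledge n) a b {p i} →
               T (call K (a , b) p i) → T (K p i) ⊎ T (K a i) ⊎ T (K b i)
call-sources K a b {p} {i} with ⌊ p ≟ a ⌋ ∨ ⌊ p ≟ b ⌋
... | true  = inj₂ ∘ Equivalence.to T-∨
... | false = inj₁

call-bystander : ∀ (K : Knowledge n) {a b p i} → p ≢ a → p ≢ b → call K (a , b) p i ≡ K p i
call-bystander K {a} {b} {p} p≢a p≢b with p ≟ a | p ≟ b
... | yes p≡a | _       = ⊥-elim (p≢a p≡a)
... | no _    | yes p≡b = ⊥-elim (p≢b p≡b)
... | no _    | no _    = refl

JointlyKnow : Knowledge n → Vector Bool n → Vector Bool n → Set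
JointlyKnow K G I = ∀ i → T (I i) → ∃[ p ] T (G p) × T (K p i)

ExcessAtMost : ℕ → Knowledge n → Set
ExcessAtMost j K = ∀ G I → JointlyKnow K G I → countTrue I ≤ j + countTrue G

excess-initial : ExcessAtMost 0 (initial {n})
excess-initial G I G-knows-I = countTrue-mono I⊆G
  where
  I⊆G : ∀ i → T (I i) → T (G i)
  I⊆G i Ii with G-knows-I i Ii
  ... | p , Gp , p≡i = subst (T ∘ G) (toWitness p≡i) Gp

jointlyKnow-∪⁅⁆ : ∀ {K K′ : Knowledge n} {x y G I} →
                  (∀ {p i} → T (K′ p i) → T (K p i) ⊎ T (K x i) ⊎ T (K y i)) →
                  T (G x) → JointlyKnow K′ G I → JointlyKnow K (G ∪ ⁅ y ⁆) I
jointlyKnow-∪⁅⁆ {x = x} {y} {G} sources Gx G-knows-I i Ii with G-knows-I i Ii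
... | p , Gp , K′pi with sources K′pi
...   | inj₁ Kpi        = p , ∪⁺ G ⁅ y ⁆ (inj₁ Gp) , Kpi
...   | inj₂ (inj₁ Kxi) = x , ∪⁺ G ⁅ y ⁆ (inj₁ Gx) , Kxi
...   | inj₂ (inj₂ Kyi) = y , ∪⁺ G ⁅ y ⁆ (inj₂ (x∈⁅x⁆ y)) , Kyi

jointlyKnow-bystanders : ∀ {K : Knowledge n} {a b G I} → ¬ T (G a) → ¬ T (G b) →
                         JointlyKnow (call K (a , b)) G I → JointlyKnow K G I
jointlyKnow-bystanders {K = K} {G = G} ¬Ga ¬Gb G-knows-I i Ii with G-knows-I i Ii
... | p , Gp , K′pi =
  p , Gp , subst T (call-bystander K (λ { refl → ¬Ga Gp }) (λ { refl → ¬Gb Gp })) K′pi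

excess-absorb : ∀ {K K′ : Knowledge n} {x y} → ExcessAtMost j K →
             (∀ {p i} → T (K′ p i) → T (K p i) ⊎ T (K x i) ⊎ T (K y i)) →
             ∀ {G I} → T (G x) → JointlyKnow K′ G I → countTrue I ≤ suc j + countTrue G
excess-absorb {j = j} {y = y} excess sources {G} {I} Gx G-knows-I = begin
  countTrue I                ≤⟨ excess (G ∪ ⁅ y ⁆) I (jointlyKnow-∪⁅⁆ sources Gx G-knows-I) ⟩
  j + countTrue (G ∪ ⁅ y ⁆)  ≤⟨ +-monoʳ-≤ j (countTrue-∪⁅⁆ G y) ⟩
  j + suc (countTrue G)      ≡⟨ +-suc j (countTrue G) ⟩
  suc j + countTrue G        ∎
  where open ≤-Reasoning

excess-call : ∀ {K : Knowledge n} → ExcessAtMost j K → ∀ a b → ExcessAtMost (suc j) (call K (a , b))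
excess-call {K = K} excess a b G I G-knows-I with T? (G a) | T? (G b)
... | yes Ga | _      = excess-absorb excess (call-sources K a b) Ga G-knows-I
... | no _   | yes Gb = excess-absorb excess (Sum.map₂ Sum.swap ∘ call-sources K a b) Gb G-knows-I
... | no ¬Ga | no ¬Gb = m≤n⇒m≤1+n (excess G I (jointlyKnow-bystanders ¬Ga ¬Gb G-knows-I))

excess-foldl : ∀ {K : Knowledge n} (cs : List (Call n)) →
               ExcessAtMost j K → ExcessAtMost (length cs + j) (foldl call K cs)
excess-foldl           []             excess = excess
excess-foldl {j = j} {K = K} ((a , b) ∷ cs) excess =
  subst (λ m → ExcessAtMost m (foldl call K ((a , b) ∷ cs))) (+-suc (length cs) j)
        (excess-foldl cs (excess-call excess a b))

excess-run : (cs : List (Call n)) → ExcessAtMost (length cs) (run cs)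
excess-run cs =
  subst (λ m → ExcessAtMost m (run cs)) (+-identityʳ (length cs)) (excess-foldl cs excess-initial)

news-≤ : ∀ {K : Knowledge n} → ExcessAtMost j K → (c : Call n) → news K c ≤ j + 2
news-≤ {j = j} {K = K} excess (a , b) = begin
  news K (a , b)                 ≤⟨ countTrue-+-≤ (λ i → bit-news-≤ (K a i) (K b i) (from-a i) (from-b i)) ⟩
  countTrue (K a ∪ K b)          ≤⟨ excess (⁅ a ⁆ ∪ ⁅ b ⁆) (K a ∪ K b) callers-know ⟩
  j + countTrue (⁅ a ⁆ ∪ ⁅ b ⁆)  ≤⟨ +-monoʳ-≤ j (countTrue-∪⁅⁆ ⁅ a ⁆ b) ⟩
  j + suc (countTrue ⁅ a ⁆)      ≡⟨ cong (λ m → j + suc m) (countTrue-⁅⁆ a) ⟩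
  j + 2                          ∎
  where
  open ≤-Reasoning
  from-a : ∀ i → T (call K (a , b) a i) → T (K a i) ⊎ T (K b i)
  from-a i = Sum.[ inj₁ , id ] ∘ call-sources K a b {a} {i}
  from-b : ∀ i → T (call K (a , b) b i) → T (K a i) ⊎ T (K b i)
  from-b i = Sum.[ inj₂ , id ] ∘ call-sources K a b {b} {i}
  callers-know : JointlyKnow K (⁅ a ⁆ ∪ ⁅ b ⁆) (K a ∪ K b)
  callers-know i Kai∨Kbi with Equivalence.to T-∨ Kai∨Kbi
  ... | inj₁ Kai = a , ∪⁺ ⁅ a ⁆ ⁅ b ⁆ (inj₁ (x∈⁅x⁆ a)) , Kai
  ... | inj₂ Kbi = b , ∪⁺ ⁅ a ⁆ ⁅ b ⁆ (inj₂ (x∈⁅x⁆ b)) , Kbi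

mainTheorem2 : (n : ℕ) (calls : List (Call n)) → All ValidCall calls →
    (k : Fin (length calls)) → suc (toℕ k) < n →
    news (run (take (toℕ k) calls)) (lookup calls k) ≤ suc (toℕ k) + 1
mainTheorem2 n calls _ k _ = begin
  news (run (take t calls)) (lookup calls k)  ≤⟨ news-≤ (excess-run (take t calls)) (lookup calls k) ⟩
  length (take t calls) + 2                   ≡⟨ cong (_+ 2) (length-take t calls) ⟩
  t ⊓ length calls + 2                        ≤⟨ +-monoˡ-≤ 2 (m⊓n≤m t (length calls)) ⟩
  t + 2                                       ≡⟨ +-suc t 1 ⟩
  suc t + 1                                   ∎
  where
  open ≤-Reasoning
  t = toℕ k
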